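{- $\mathrm{PSL}_2(\mathbb{H}ur(\mathbb{Z}))$ has only one cusp; that is, every point of $\mathcal{B}_{\mathbb{Q}}\cup\{\infty\}$ lies in the $\mathrm{PSL}_2(\mathbb{H}ur(\mathbb{Z}))$-orbit of $\infty$ under the action by quaternionic Möbius transformations.
   Context: $\mathbb{H}$ denotes Hamilton's quaternions, $\mathcal{B}_{\mathbb{Q}}=\mathbb{Q}\oplus\mathbb{Q}i\oplus\mathbb{Q}j\oplus\mathbb{Q}k\subseteq\mathbb{H}$, and $\mathbb{H}ur(\mathbb{Z})=\mathbb{Z}\oplus\mathbb{Z}i\oplus\mathbb{Z}j\oplus\mathbb{Z}\xi$ with $\xi=\frac{1+i+j+k}{2}$ (the Hurwitz integers). $\mathrm{SL}_2(\mathbb{H}ur(\mathbb{Z}))$ is the group of $2\times 2$ matrices $\begin{pmatrix}a&b\\c&d\end{pmatrix}$ with entries in $\mathbb{H}ur(\mathbb{Z})$ and Dieudonné determinant $\sqrt{|a|^2|d|^2+|c|^2|b|^2-2\Re(c\overline{a}b\overline{d})}=1$, and $\mathrm{PSL}_2=\mathrm{SL}_2/\{\pm I\}$. It acts on $\mathbb{H}\cup\{\infty\}$ by $F_\gamma(\mathbf{q})=(a\mathbf{q}+b)(c\mathbf{q}+d)^{ -1}$, with $F_\gamma(\infty)=\infty$ if $c=0$, $F_\gamma(\infty)=ac^{ -1}$ if $c\neq0$, and $F_\gamma(-c^{ -1}d)=\infty$. A cusp of $\mathrm{PSL}_2(\mathbb{H}ur(\mathbb{Z}))$ is an orbit of this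 group on $\mathcal{B}_{\mathbb{Q}}\cup\{\infty\}$. -}

module Defs where

open import Data.Integer using (ℤ)
open import Data.Rational as ℚ using (ℚ; 0ℚ; 1ℚ; _+_; _*_; _-_; -_; _≟_)
open import Data.Product using (Σ; _×_; _,_; ∃-syntax)
open import Relation.Binary.PropositionalEquality using (_≡_; _≢_)
open import Relation.Nullary using (yes; no)

record Quat : Set where
  constructor quat
  field
    re  : ℚ
    im₁ : ℚ
    im₂ : ℚ
    im₃ : ℚ
open Quat public

infixl 6 _+ᴴ_
infixl 7 _*ᴴ_

_+ᴴ_ : Quat → Quat → Quat
quat a b c d +ᴴ quat e f g h = quat (a + e) (b + f) (c + g) (d + h)

-- Hamilton product  (i² = j² = k² = ijk = -1)
_*ᴴ_ : Quat → Quat → Quat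
quat a b c d *ᴴ quat e f g h =
  quat (a * e - b * f - c * g - d * h)
       (a * f + b * e + c * h - d * g)
       (a * g - b * h + c * e + d * f)
       (a * h + b * g - c * f + d * e)

conj : Quat → Quat
conj (quat a b c d) = quat a (- b) (- c) (- d)

normSq : Quat → ℚ
normSq (quat a b c d) = a * a + b * b + c * c + d * d

0ᴴ 1ᴴ iᴴ jᴴ kᴴ : Quat
0ᴴ = quat 0ℚ 0ℚ 0ℚ 0ℚ
1ᴴ = quat 1ℚ 0ℚ 0ℚ 0ℚ
iᴴ = quat 0ℚ 1ℚ 0ℚ 0ℚ
jᴴ = quat 0ℚ 0ℚ 1ℚ 0ℚ
kᴴ = quat 0ℚ 0ℚ 0ℚ 1ℚ

ofℚ : ℚ → Quat
ofℚ r = quat r 0ℚ 0ℚ 0ℚ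

ξ : Quat
ξ = quat ½ ½ ½ ½
  where ½ = ℚ.½

-- Multiplicative inverse q⁻¹ = q̄ / |q|²  (for q ≠ 0; returns 0 at q = 0, never used there)
inv : Quat → Quat
inv q with normSq q ≟ 0ℚ
... | yes _ = 0ᴴ
... | no n≢0 = ofℚ (ℚ.1/_ (normSq q) {{ℚ.≢-nonZero n≢0}}) *ᴴ conj q

ofℤ : ℤ → Quat
ofℤ m = ofℚ (m ℚ./ 1)

IsHurwitz : Quat → Set
IsHurwitz q = ∃[ m₀ ] ∃[ m₁ ] ∃[ m₂ ] ∃[ m₃ ]
  (q ≡ ofℤ m₀ +ᴴ ofℤ m₁ *ᴴ iᴴ +ᴴ ofℤ m₂ *ᴴ jᴴ +ᴴ ofℤ m₃ *ᴴ ξ)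

record Mat₂ : Set where
  constructor mat
  field
    a b c d : Quat
open Mat₂ public

-- Square of the Dieudonné determinant:
-- |a|²|d|² + |c|²|b|² - 2 Re(c ā b d̄)
dieudonnéSq : Mat₂ → ℚ
dieudonnéSq (mat a b c d) =
  normSq a * normSq d + normSq c * normSq b
  - (1ℚ + 1ℚ) * re (c *ᴴ conj a *ᴴ b *ᴴ conj d)

-- γ ∈ SL₂(Hur(Z)): Hurwitz entries and Dieudonné determinant 1.
-- (The determinant is the nonnegative square root, so "= 1" iff its square is 1.)
InSL₂Hur : Mat₂ → Set
InSL₂Hur γ = IsHurwitz (a γ) × IsHurwitz (b γ) × IsHurwitz (c γ) × IsHurwitz (d γ)
           × dieudonnéSq γ ≡ 1ℚ

data Point : Set where
  fin : Quat → Point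
  ∞   : Point

act : Mat₂ → Point → Point
act (mat a b c d) ∞ with normSq c ≟ 0ℚ
... | yes _ = ∞
... | no  _ = fin (a *ᴴ inv c)
act (mat a b c d) (fin q) with normSq (c *ᴴ q +ᴴ d) ≟ 0ℚ
... | yes _ = ∞
... | no  _ = fin ((a *ᴴ q +ᴴ b) *ᴴ inv (c *ᴴ q +ᴴ d))

-- The PSL₂(Hur(Z))-orbit of a point (−I acts trivially, so PSL₂- and SL₂-orbits agree)
InOrbit : Point → Point → Set
InOrbit x y = ∃[ γ ] (InSL₂Hur γ × act γ x ≡ y)

-- A rational quaternion q has a Hurwitz denominator: a nonzero Hurwitz integer β with qβ
-- Hurwitz, e.g. the product of the denominators of its coordinates. Induct on the norm of β,
-- a natural number. If q is Hurwitz, (q 1; 1 0) ∈ SL₂(Hur ℤ) sends ∞ to q. Otherwise some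
-- Hurwitz integer h has 0 < |h − q| < 1, and (h − q)β is a Hurwitz denominator of (h − q)⁻¹
-- of smaller norm. So some γ ∈ SL₂(Hur ℤ) sends ∞ to (h − q)⁻¹, and then (h −1; 1 0)γ, whose
-- Dieudonné determinant is that of γ, sends ∞ to h − (h − q) = q.
module Submission where

open import Defs
open import Data.Empty using (⊥-elim)
open import Data.Fin using (Fin; #_; combine; _↑ˡ_; _↑ʳ_)
open import Data.Integer as ℤ using (ℤ; +_)
open import Data.Integer.DivMod using (_%_; a≡a%n+[a/n]*n; n%d<d)
import Data.Integer.Properties as ℤₚ
open import Data.Nat as ℕ using (ℕ)
import Data.Nat.Properties as ℕₚ
open import Data.Nat.Divisibility using (_∣_; divides; m∣m*n; n∣m*n; ∣m⇒∣m*n)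
open import Data.Nat.Induction using (<-rec)
open import Data.Product using (Σ; _×_; _,_; proj₁; proj₂; ∃-syntax)
open import Data.Rational as ℚ using (ℚ; mkℚ; 0ℚ; 1ℚ; ½; _+_; _*_; _-_; -_; _≟_; _≤_; _<_; ↥_; ↧_; ↧ₙ_)
import Data.Rational.Properties as ℚₚ
open import Data.Rational.Solver using (module +-*-Solver)
open +-*-Solver using (Polynomial; con; var; _:+_; _:*_; _:-_; :-_; ⟦_⟧; ⟦_⟧↓; prove; solve; _:=_)
open import Data.Rational.Unnormalised using (mkℚᵘ; _≃_; *≡*; *≤*; *<*)
import Data.Rational.Unnormalised.Properties as ℚᵘₚ
open import Data.Sum using (_⊎_; inj₁; inj₂; [_,_]′)
open import Data.Vec as Vec using (Vec; []; _∷_; _++_; concat)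
import Data.Vec.Properties as Vecₚ
open import Relation.Binary.PropositionalEquality
open import Relation.Nullary using (Dec; yes; no)
open import Relation.Binary.Definitions using (tri<; tri≈; tri>)

fromℤ : ℤ → ℚ
fromℤ m = m ℚ./ 1

IsInteger : ℚ → Set
IsInteger r = Σ ℤ λ m → fromℤ m ≡ r

toℚᵘ-fromℤ : ∀ m → ℚ.toℚᵘ (fromℤ m) ≃ mkℚᵘ m 0
toℚᵘ-fromℤ m = ℚₚ.toℚᵘ-fromℚᵘ (mkℚᵘ m 0)

fromℤ-≡ : ∀ m {r} → ℚ.toℚᵘ r ≃ mkℚᵘ m 0 → fromℤ m ≡ r
fromℤ-≡ m eq = ℚₚ.toℚᵘ-injective (ℚᵘₚ.≃-trans (toℚᵘ-fromℤ m) (ℚᵘₚ.≃-sym eq))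

fromℤ-+ : ∀ m n → fromℤ (m ℤ.+ n) ≡ fromℤ m + fromℤ n
fromℤ-+ m n = fromℤ-≡ (m ℤ.+ n) (ℚᵘₚ.≃-trans (ℚₚ.toℚᵘ-homo-+ (fromℤ m) (fromℤ n))
  (ℚᵘₚ.≃-trans (ℚᵘₚ.+-cong (toℚᵘ-fromℤ m) (toℚᵘ-fromℤ n))
    (*≡* (cong (ℤ._* + 1) (cong₂ ℤ._+_ (ℤₚ.*-identityʳ m) (ℤₚ.*-identityʳ n))))))

fromℤ-* : ∀ m n → fromℤ (m ℤ.* n) ≡ fromℤ m * fromℤ n
fromℤ-* m n = fromℤ-≡ (m ℤ.* n) (ℚᵘₚ.≃-trans (ℚₚ.toℚᵘ-homo-* (fromℤ m) (fromℤ n))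
  (ℚᵘₚ.*-cong (toℚᵘ-fromℤ m) (toℚᵘ-fromℤ n)))

fromℤ-neg : ∀ m → fromℤ (ℤ.- m) ≡ - fromℤ m
fromℤ-neg m = fromℤ-≡ (ℤ.- m) (ℚᵘₚ.≃-trans (ℚₚ.toℚᵘ-homo‿- (fromℤ m)) (ℚᵘₚ.-‿cong (toℚᵘ-fromℤ m)))

*-denominator : ∀ p → p * fromℤ (↧ p) ≡ fromℤ (↥ p)
*-denominator p@(mkℚ n d-1 _) = sym (fromℤ-≡ n (ℚᵘₚ.≃-trans (ℚₚ.toℚᵘ-homo-* p (fromℤ (↧ p)))
  (ℚᵘₚ.≃-trans (ℚᵘₚ.*-congˡ {ℚ.toℚᵘ p} (toℚᵘ-fromℤ (↧ p))) (*≡* lemma))))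
  where
  lemma : n ℤ.* + ℕ.suc d-1 ℤ.* + 1 ≡ n ℤ.* + ℕ.suc (d-1 ℕ.* 1)
  lemma rewrite ℕₚ.*-identityʳ d-1 = ℤₚ.*-identityʳ (n ℤ.* + ℕ.suc d-1)

fromℤ-mono-≤ : ∀ {m n} → m ℤ.≤ n → fromℤ m ≤ fromℤ n
fromℤ-mono-≤ {m} {n} m≤n = ℚₚ.toℚᵘ-cancel-≤
  (ℚᵘₚ.≤-respˡ-≃ (ℚᵘₚ.≃-sym (toℚᵘ-fromℤ m)) (ℚᵘₚ.≤-respʳ-≃ (ℚᵘₚ.≃-sym (toℚᵘ-fromℤ n))
    (*≤* (subst₂ ℤ._≤_ (sym (ℤₚ.*-identityʳ m)) (sym (ℤₚ.*-identityʳ n)) m≤n))))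

fromℤ-mono-< : ∀ {m n} → m ℤ.< n → fromℤ m < fromℤ n
fromℤ-mono-< {m} {n} m<n = ℚₚ.toℚᵘ-cancel-<
  (ℚᵘₚ.<-respˡ-≃ (ℚᵘₚ.≃-sym (toℚᵘ-fromℤ m)) (ℚᵘₚ.<-respʳ-≃ (ℚᵘₚ.≃-sym (toℚᵘ-fromℤ n))
    (*<* (subst₂ ℤ._<_ (sym (ℤₚ.*-identityʳ m)) (sym (ℤₚ.*-identityʳ n)) m<n))))

fromℤ-cancel-≤ : ∀ {m n} → fromℤ m ≤ fromℤ n → m ℤ.≤ n
fromℤ-cancel-≤ {m} {n} le
  with ℚᵘₚ.≤-respˡ-≃ (toℚᵘ-fromℤ m) (ℚᵘₚ.≤-respʳ-≃ (toℚᵘ-fromℤ n) (ℚₚ.toℚᵘ-mono-≤ le))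
... | *≤* m*1≤n*1 = subst₂ ℤ._≤_ (ℤₚ.*-identityʳ m) (ℤₚ.*-identityʳ n) m*1≤n*1

fromℤ-cancel-< : ∀ {m n} → fromℤ m < fromℤ n → m ℤ.< n
fromℤ-cancel-< {m} {n} lt
  with ℚᵘₚ.<-respˡ-≃ (toℚᵘ-fromℤ m) (ℚᵘₚ.<-respʳ-≃ (toℚᵘ-fromℤ n) (ℚₚ.toℚᵘ-mono-< lt))
... | *<* m*1<n*1 = subst₂ ℤ._<_ (ℤₚ.*-identityʳ m) (ℤₚ.*-identityʳ n) m*1<n*1

fromℤ-pos : ∀ n .{{_ : ℕ.NonZero n}} → 0ℚ < fromℤ (+ n)
fromℤ-pos n = fromℤ-mono-< {+ 0} {+ n} (ℤ.+<+ (ℕ.>-nonZero⁻¹ n))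

denominator-clears : ∀ p {n} → ↧ₙ p ∣ n → IsInteger (p * fromℤ (+ n))
denominator-clears p (divides k refl) = + k ℤ.* ↥ p , (begin
  fromℤ (+ k ℤ.* ↥ p)                 ≡⟨ fromℤ-* (+ k) (↥ p) ⟩
  fromℤ (+ k) * fromℤ (↥ p)           ≡⟨ cong (fromℤ (+ k) *_) (*-denominator p) ⟨
  fromℤ (+ k) * (p * fromℤ (↧ p))     ≡⟨ solve 3 (λ K P D → K :* (P :* D) := P :* (K :* D)) refl (fromℤ (+ k)) p (fromℤ (↧ p)) ⟩
  p * (fromℤ (+ k) * fromℤ (↧ p))     ≡⟨ cong (p *_) (trans (cong fromℤ (ℤₚ.pos-* k (↧ₙ p))) (fromℤ-* (+ k) (↧ p))) ⟨
  p * fromℤ (+ (k ℕ.* ↧ₙ p))          ∎)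
  where open ≡-Reasoning

-- Quaternions over the ring solver's polynomial syntax. ⟦ X *ᴾ Y ⟧ᴴ ρ reduces to
-- ⟦ X ⟧ᴴ ρ *ᴴ ⟦ Y ⟧ᴴ ρ, and likewise for the other operations, so proveᴴ turns a
-- quaternion identity into four ring identities, checked by comparing normal forms.
record Quatᴾ (n : ℕ) : Set where
  constructor quatᴾ
  field
    reᴾ im₁ᴾ im₂ᴾ im₃ᴾ : Polynomial n
open Quatᴾ

module _ {n : ℕ} where

  infixl 6 _+ᴾ_ _-ᴾ_
  infixl 7 _*ᴾ_

  _+ᴾ_ _-ᴾ_ _*ᴾ_ : Quatᴾ n → Quatᴾ n → Quatᴾ n
  quatᴾ a b c d +ᴾ quatᴾ e f g h = quatᴾ (a :+ e) (b :+ f) (c :+ g) (d :+ h)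
  quatᴾ a b c d -ᴾ quatᴾ e f g h = quatᴾ (a :- e) (b :- f) (c :- g) (d :- h)
  quatᴾ a b c d *ᴾ quatᴾ e f g h =
    quatᴾ (a :* e :- b :* f :- c :* g :- d :* h)
          (a :* f :+ b :* e :+ c :* h :- d :* g)
          (a :* g :- b :* h :+ c :* e :+ d :* f)
          (a :* h :+ b :* g :- c :* f :+ d :* e)

  conjᴾ : Quatᴾ n → Quatᴾ n
  conjᴾ (quatᴾ a b c d) = quatᴾ a (:- b) (:- c) (:- d)

  normSqᴾ : Quatᴾ n → Polynomial n
  normSqᴾ (quatᴾ a b c d) = a :* a :+ b :* b :+ c :* c :+ d :* d

  ofℚᴾ : Polynomial n → Quatᴾ n
  ofℚᴾ r = quatᴾ r (con 0ℚ) (con 0ℚ) (con 0ℚ)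

  0ᴾ 1ᴾ iᴾ jᴾ ξᴾ : Quatᴾ n
  0ᴾ = ofℚᴾ (con 0ℚ)
  1ᴾ = ofℚᴾ (con 1ℚ)
  iᴾ = quatᴾ (con 0ℚ) (con 1ℚ) (con 0ℚ) (con 0ℚ)
  jᴾ = quatᴾ (con 0ℚ) (con 0ℚ) (con 1ℚ) (con 0ℚ)
  ξᴾ = quatᴾ (con ½) (con ½) (con ½) (con ½)

  hurᴾ : (p₀ p₁ p₂ p₃ : Polynomial n) → Quatᴾ n
  hurᴾ p₀ p₁ p₂ p₃ = ofℚᴾ p₀ +ᴾ ofℚᴾ p₁ *ᴾ iᴾ +ᴾ ofℚᴾ p₂ *ᴾ jᴾ +ᴾ ofℚᴾ p₃ *ᴾ ξᴾ

  dieudonnéSqᴾ : (a b c d : Quatᴾ n) → Polynomial n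
  dieudonnéSqᴾ a b c d = normSqᴾ a :* normSqᴾ d :+ normSqᴾ c :* normSqᴾ b
    :- (con 1ℚ :+ con 1ℚ) :* reᴾ (c *ᴾ conjᴾ a *ᴾ b *ᴾ conjᴾ d)

  ⟦_⟧ᴴ ⟦_⟧ᴴ↓ : Quatᴾ n → Vec ℚ n → Quat
  ⟦ quatᴾ a b c d ⟧ᴴ  ρ = quat (⟦ a ⟧ ρ) (⟦ b ⟧ ρ) (⟦ c ⟧ ρ) (⟦ d ⟧ ρ)
  ⟦ quatᴾ a b c d ⟧ᴴ↓ ρ = quat (⟦ a ⟧↓ ρ) (⟦ b ⟧↓ ρ) (⟦ c ⟧↓ ρ) (⟦ d ⟧↓ ρ)

quat-cong : ∀ {a b c d a′ b′ c′ d′} → a ≡ a′ → b ≡ b′ → c ≡ c′ → d ≡ d′ →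
            quat a b c d ≡ quat a′ b′ c′ d′
quat-cong refl refl refl refl = refl

proveᴴ : ∀ {n} (ρ : Vec ℚ n) (X Y : Quatᴾ n) → ⟦ X ⟧ᴴ↓ ρ ≡ ⟦ Y ⟧ᴴ↓ ρ → ⟦ X ⟧ᴴ ρ ≡ ⟦ Y ⟧ᴴ ρ
proveᴴ ρ (quatᴾ a b c d) (quatᴾ e f g h) eq =
  quat-cong (prove ρ a e (cong re eq)) (prove ρ b f (cong im₁ eq))
            (prove ρ c g (cong im₂ eq)) (prove ρ d h (cong im₃ eq))

module Variables (k m : ℕ) where

  infixr 5 _⨾_
  _⨾_ : Vec Quat k → Vec ℚ m → Vec ℚ (k ℕ.* 4 ℕ.+ m)
  xs ⨾ ss = concat (Vec.map (λ (quat a b c d) → a ∷ b ∷ c ∷ d ∷ []) xs) ++ ss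

  𝕢 : Fin k → Quatᴾ (k ℕ.* 4 ℕ.+ m)
  𝕢 i = quatᴾ (coordinate (# 0)) (coordinate (# 1)) (coordinate (# 2)) (coordinate (# 3))
    where
    coordinate : Fin 4 → Polynomial (k ℕ.* 4 ℕ.+ m)
    coordinate j = var (combine i j ↑ˡ m)

  𝕤 : Fin m → Polynomial (k ℕ.* 4 ℕ.+ m)
  𝕤 j = var (k ℕ.* 4 ↑ʳ j)

module Coordinates₄ where
  open Variables 0 4 public
  x₀ = 𝕤 (# 0)
  x₁ = 𝕤 (# 1)
  x₂ = 𝕤 (# 2)
  x₃ = 𝕤 (# 3)

module Coordinates₈ where
  open Variables 0 8 public
  x₀ = 𝕤 (# 0)
  x₁ = 𝕤 (# 1)
  x₂ = 𝕤 (# 2)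
  x₃ = 𝕤 (# 3)
  y₀ = 𝕤 (# 4)
  y₁ = 𝕤 (# 5)
  y₂ = 𝕤 (# 6)
  y₃ = 𝕤 (# 7)

infixl 6 _-ᴴ_
_-ᴴ_ : Quat → Quat → Quat
quat a b c d -ᴴ quat e f g h = quat (a - e) (b - f) (c - g) (d - h)

*ᴴ-assoc : ∀ x y z → (x *ᴴ y) *ᴴ z ≡ x *ᴴ (y *ᴴ z)
*ᴴ-assoc x y z = proveᴴ ((x ∷ y ∷ z ∷ []) ⨾ []) ((X *ᴾ Y) *ᴾ Z) (X *ᴾ (Y *ᴾ Z)) refl
  where
  open Variables 3 0
  X = 𝕢 (# 0)
  Y = 𝕢 (# 1)
  Z = 𝕢 (# 2)

*ᴴ-identityˡ : ∀ x → 1ᴴ *ᴴ x ≡ x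
*ᴴ-identityˡ x = proveᴴ ((x ∷ []) ⨾ []) (1ᴾ *ᴾ X) X refl
  where
  open Variables 1 0
  X = 𝕢 (# 0)

*ᴴ-identityʳ : ∀ x → x *ᴴ 1ᴴ ≡ x
*ᴴ-identityʳ x = proveᴴ ((x ∷ []) ⨾ []) (X *ᴾ 1ᴾ) X refl
  where
  open Variables 1 0
  X = 𝕢 (# 0)

*ᴴ-distribʳ--ᴴ : ∀ x y z → (x -ᴴ y) *ᴴ z ≡ x *ᴴ z -ᴴ y *ᴴ z
*ᴴ-distribʳ--ᴴ x y z = proveᴴ ((x ∷ y ∷ z ∷ []) ⨾ []) ((X -ᴾ Y) *ᴾ Z) (X *ᴾ Z -ᴾ Y *ᴾ Z) refl
  where
  open Variables 3 0
  X = 𝕢 (# 0)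
  Y = 𝕢 (# 1)
  Z = 𝕢 (# 2)

x-ᴴ[x-ᴴy]≡y : ∀ x y → x -ᴴ (x -ᴴ y) ≡ y
x-ᴴ[x-ᴴy]≡y x y = proveᴴ ((x ∷ y ∷ []) ⨾ []) (X -ᴾ (X -ᴾ Y)) Y refl
  where
  open Variables 2 0
  X = 𝕢 (# 0)
  Y = 𝕢 (# 1)

x-ᴴ0≡x : ∀ x → x -ᴴ 0ᴴ ≡ x
x-ᴴ0≡x x = proveᴴ ((x ∷ []) ⨾ []) (X -ᴾ 0ᴾ) X refl
  where
  open Variables 1 0
  X = 𝕢 (# 0)

normSq-*ᴴ : ∀ x y → normSq (x *ᴴ y) ≡ normSq x * normSq y
normSq-*ᴴ x y = prove ((x ∷ y ∷ []) ⨾ []) (normSqᴾ (X *ᴾ Y)) (normSqᴾ X :* normSqᴾ Y) refl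
  where
  open Variables 2 0
  X = 𝕢 (# 0)
  Y = 𝕢 (# 1)

normSq-ofℚ : ∀ r → normSq (ofℚ r) ≡ r * r
normSq-ofℚ r = prove ([] ⨾ (r ∷ [])) (normSqᴾ (ofℚᴾ s)) (s :* s) refl
  where
  open Variables 0 1
  s = 𝕤 (# 0)

*ᴴ-ofℚ : ∀ x r → x *ᴴ ofℚ r ≡ quat (re x * r) (im₁ x * r) (im₂ x * r) (im₃ x * r)
*ᴴ-ofℚ x r = proveᴴ ((x ∷ []) ⨾ (r ∷ [])) (X *ᴾ ofℚᴾ s)
  (quatᴾ (reᴾ X :* s) (im₁ᴾ X :* s) (im₂ᴾ X :* s) (im₃ᴾ X :* s)) refl
  where
  open Variables 1 1
  X = 𝕢 (# 0)
  s = 𝕤 (# 0)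

*ᴴ-scaled-conjʳ : ∀ x r → x *ᴴ (ofℚ r *ᴴ conj x) ≡ ofℚ (r * normSq x)
*ᴴ-scaled-conjʳ x r = proveᴴ ((x ∷ []) ⨾ (r ∷ [])) (X *ᴾ (ofℚᴾ s *ᴾ conjᴾ X)) (ofℚᴾ (s :* normSqᴾ X)) refl
  where
  open Variables 1 1
  X = 𝕢 (# 0)
  s = 𝕤 (# 0)

*ᴴ-scaled-conjˡ : ∀ x r → (ofℚ r *ᴴ conj x) *ᴴ x ≡ ofℚ (r * normSq x)
*ᴴ-scaled-conjˡ x r = proveᴴ ((x ∷ []) ⨾ (r ∷ [])) ((ofℚᴾ s *ᴾ conjᴾ X) *ᴾ X) (ofℚᴾ (s :* normSqᴾ X)) refl
  where
  open Variables 1 1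
  X = 𝕢 (# 0)
  s = 𝕤 (# 0)

square-pos : ∀ p → p ≢ 0ℚ → 0ℚ < p * p
square-pos p p≢0 with ℚₚ.<-cmp p 0ℚ
... | tri< p<0 _ _ = ℚₚ.positive⁻¹ (p * p) {{ℚₚ.neg*neg⇒pos p {{ℚ.negative p<0}} p {{ℚ.negative p<0}}}}
... | tri≈ _ p≡0 _ = ⊥-elim (p≢0 p≡0)
... | tri> _ _ p>0 = ℚₚ.positive⁻¹ (p * p) {{ℚₚ.pos*pos⇒pos p {{ℚ.positive p>0}} p {{ℚ.positive p>0}}}}

square-nonneg : ∀ p → 0ℚ ≤ p * p
square-nonneg p with p ≟ 0ℚ
... | yes refl = ℚₚ.≤-refl
... | no p≢0 = ℚₚ.<⇒≤ (square-pos p p≢0)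

nonneg∧≢0⇒pos : ∀ {p} → 0ℚ ≤ p → p ≢ 0ℚ → 0ℚ < p
nonneg∧≢0⇒pos {p} 0≤p p≢0 with ℚₚ.<-cmp p 0ℚ
... | tri< p<0 _ _ = ⊥-elim (ℚₚ.<-irrefl refl (ℚₚ.<-≤-trans p<0 0≤p))
... | tri≈ _ p≡0 _ = ⊥-elim (p≢0 p≡0)
... | tri> _ _ p>0 = p>0

+-nonneg-≡0 : ∀ {p q} → 0ℚ ≤ p → 0ℚ ≤ q → p + q ≡ 0ℚ → p ≡ 0ℚ × q ≡ 0ℚ
+-nonneg-≡0 {p} {q} 0≤p 0≤q p+q≡0 =
  ℚₚ.≤-antisym (subst (p ≤_) p+q≡0 (p≤p+q 0≤q)) 0≤p ,
  ℚₚ.≤-antisym (subst (q ≤_) (trans (ℚₚ.+-comm q p) p+q≡0) (p≤p+q 0≤p)) 0≤q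
  where
  p≤p+q : ∀ {r s} → 0ℚ ≤ s → r ≤ r + s
  p≤p+q {r} 0≤s = subst (_≤ r + _) (ℚₚ.+-identityʳ r) (ℚₚ.+-monoʳ-≤ r 0≤s)

sum₄-nonneg : ∀ {a b c d} → 0ℚ ≤ a → 0ℚ ≤ b → 0ℚ ≤ c → 0ℚ ≤ d → 0ℚ ≤ a + b + c + d
sum₄-nonneg 0≤a 0≤b 0≤c 0≤d = ℚₚ.+-mono-≤ (ℚₚ.+-mono-≤ (ℚₚ.+-mono-≤ 0≤a 0≤b) 0≤c) 0≤d

sum₄-nonneg-≡0 : ∀ {a b c d} → 0ℚ ≤ a → 0ℚ ≤ b → 0ℚ ≤ c → 0ℚ ≤ d → a + b + c + d ≡ 0ℚ →
                 a ≡ 0ℚ × b ≡ 0ℚ × c ≡ 0ℚ × d ≡ 0ℚ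
sum₄-nonneg-≡0 0≤a 0≤b 0≤c 0≤d sum≡0
  with +-nonneg-≡0 (ℚₚ.+-mono-≤ (ℚₚ.+-mono-≤ 0≤a 0≤b) 0≤c) 0≤d sum≡0
... | abc≡0 , d≡0 with +-nonneg-≡0 (ℚₚ.+-mono-≤ 0≤a 0≤b) 0≤c abc≡0
... | ab≡0 , c≡0 with +-nonneg-≡0 0≤a 0≤b ab≡0
... | a≡0 , b≡0 = a≡0 , b≡0 , c≡0 , d≡0

normSq-nonneg : ∀ x → 0ℚ ≤ normSq x
normSq-nonneg (quat a b c d) = sum₄-nonneg (square-nonneg a) (square-nonneg b) (square-nonneg c) (square-nonneg d)

normSq-pos : ∀ x → normSq x ≢ 0ℚ → 0ℚ < normSq x
normSq-pos x = nonneg∧≢0⇒pos (normSq-nonneg x)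

normSq≡0⇒≡0ᴴ : ∀ x → normSq x ≡ 0ℚ → x ≡ 0ᴴ
normSq≡0⇒≡0ᴴ (quat a b c d) N≡0
  with sum₄-nonneg-≡0 (square-nonneg a) (square-nonneg b) (square-nonneg c) (square-nonneg d) N≡0
... | aa≡0 , bb≡0 , cc≡0 , dd≡0 = quat-cong (root a aa≡0) (root b bb≡0) (root c cc≡0) (root d dd≡0)
  where
  root : ∀ p → p * p ≡ 0ℚ → p ≡ 0ℚ
  root p pp≡0 with p ≟ 0ℚ
  ... | yes p≡0 = p≡0
  ... | no p≢0 = ⊥-elim (ℚₚ.<⇒≢ (square-pos p p≢0) (sym pp≡0))

*-pos : ∀ {p q} → 0ℚ < p → 0ℚ < q → 0ℚ < p * q
*-pos {p} {q} 0<p 0<q = ℚₚ.positive⁻¹ (p * q) {{ℚₚ.pos*pos⇒pos p {{ℚ.positive 0<p}} q {{ℚ.positive 0<q}}}}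

normSq-*ᴴ≢0 : ∀ x y → normSq x ≢ 0ℚ → normSq y ≢ 0ℚ → normSq (x *ᴴ y) ≢ 0ℚ
normSq-*ᴴ≢0 x y x≢0 y≢0 =
  subst (_≢ 0ℚ) (sym (normSq-*ᴴ x y)) (≢-sym (ℚₚ.<⇒≢ (*-pos (normSq-pos x x≢0) (normSq-pos y y≢0))))

normSq[x-ᴴy]≡0⇒x≡y : ∀ x y → normSq (x -ᴴ y) ≡ 0ℚ → x ≡ y
normSq[x-ᴴy]≡0⇒x≡y x y N≡0 = begin
  x                  ≡⟨ x-ᴴ0≡x x ⟨
  x -ᴴ 0ᴴ            ≡⟨ cong (x -ᴴ_) (normSq≡0⇒≡0ᴴ (x -ᴴ y) N≡0) ⟨
  x -ᴴ (x -ᴴ y)      ≡⟨ x-ᴴ[x-ᴴy]≡y x y ⟩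
  y                  ∎
  where open ≡-Reasoning

inv-unfold : ∀ x (N≢0 : normSq x ≢ 0ℚ) → inv x ≡ ofℚ (ℚ.1/_ (normSq x) {{ℚ.≢-nonZero N≢0}}) *ᴴ conj x
inv-unfold x N≢0 with normSq x ≟ 0ℚ
... | yes N≡0 = ⊥-elim (N≢0 N≡0)
... | no _ = refl

*ᴴ-inverseʳ : ∀ x → normSq x ≢ 0ℚ → x *ᴴ inv x ≡ 1ᴴ
*ᴴ-inverseʳ x N≢0 = begin
  x *ᴴ inv x                            ≡⟨ cong (x *ᴴ_) (inv-unfold x N≢0) ⟩
  x *ᴴ (ofℚ (ℚ.1/ normSq x) *ᴴ conj x)  ≡⟨ *ᴴ-scaled-conjʳ x (ℚ.1/ normSq x) ⟩
  ofℚ (ℚ.1/ normSq x * normSq x)        ≡⟨ cong ofℚ (ℚₚ.*-inverseˡ (normSq x)) ⟩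
  1ᴴ                                    ∎
  where
  open ≡-Reasoning
  instance
    _ = ℚ.≢-nonZero N≢0

*ᴴ-inverseˡ : ∀ x → normSq x ≢ 0ℚ → inv x *ᴴ x ≡ 1ᴴ
*ᴴ-inverseˡ x N≢0 = begin
  inv x *ᴴ x                            ≡⟨ cong (_*ᴴ x) (inv-unfold x N≢0) ⟩
  ofℚ (ℚ.1/ normSq x) *ᴴ conj x *ᴴ x    ≡⟨ *ᴴ-scaled-conjˡ x (ℚ.1/ normSq x) ⟩
  ofℚ (ℚ.1/ normSq x * normSq x)        ≡⟨ cong ofℚ (ℚₚ.*-inverseˡ (normSq x)) ⟩
  1ᴴ                                    ∎
  where
  open ≡-Reasoning
  instance
    _ = ℚ.≢-nonZero N≢0

normSq-inv≢0 : ∀ x → normSq x ≢ 0ℚ → normSq (inv x) ≢ 0ℚ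
normSq-inv≢0 x N≢0 Ninv≡0 = ℚₚ.1≢0 (begin
  1ℚ                          ≡⟨ cong normSq (*ᴴ-inverseˡ x N≢0) ⟨
  normSq (inv x *ᴴ x)         ≡⟨ normSq-*ᴴ (inv x) x ⟩
  normSq (inv x) * normSq x   ≡⟨ cong (_* normSq x) Ninv≡0 ⟩
  0ℚ * normSq x               ≡⟨ ℚₚ.*-zeroˡ (normSq x) ⟩
  0ℚ                          ∎)
  where open ≡-Reasoning

*ᴴ-inv-cancelʳ : ∀ x y → normSq y ≢ 0ℚ → x *ᴴ y *ᴴ inv y ≡ x
*ᴴ-inv-cancelʳ x y N≢0 = begin
  x *ᴴ y *ᴴ inv y      ≡⟨ *ᴴ-assoc x y (inv y) ⟩
  x *ᴴ (y *ᴴ inv y)    ≡⟨ cong (x *ᴴ_) (*ᴴ-inverseʳ y N≢0) ⟩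
  x *ᴴ 1ᴴ              ≡⟨ *ᴴ-identityʳ x ⟩
  x                    ∎
  where open ≡-Reasoning

*ᴴ-inv-cancelʳ′ : ∀ x y → normSq y ≢ 0ℚ → x *ᴴ inv y *ᴴ y ≡ x
*ᴴ-inv-cancelʳ′ x y N≢0 = begin
  x *ᴴ inv y *ᴴ y      ≡⟨ *ᴴ-assoc x (inv y) y ⟩
  x *ᴴ (inv y *ᴴ y)    ≡⟨ cong (x *ᴴ_) (*ᴴ-inverseˡ y N≢0) ⟩
  x *ᴴ 1ᴴ              ≡⟨ *ᴴ-identityʳ x ⟩
  x                    ∎
  where open ≡-Reasoning

inv-*ᴴ-cancelˡ : ∀ x y → normSq y ≢ 0ℚ → inv y *ᴴ (y *ᴴ x) ≡ x
inv-*ᴴ-cancelˡ x y N≢0 = begin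
  inv y *ᴴ (y *ᴴ x)    ≡⟨ *ᴴ-assoc (inv y) y x ⟨
  inv y *ᴴ y *ᴴ x      ≡⟨ cong (_*ᴴ x) (*ᴴ-inverseˡ y N≢0) ⟩
  1ᴴ *ᴴ x              ≡⟨ *ᴴ-identityˡ x ⟩
  x                    ∎
  where open ≡-Reasoning

inv-involutive : ∀ x → normSq x ≢ 0ℚ → inv (inv x) ≡ x
inv-involutive x N≢0 = begin
  inv (inv x)                  ≡⟨ *ᴴ-identityˡ (inv (inv x)) ⟨
  1ᴴ *ᴴ inv (inv x)            ≡⟨ cong (_*ᴴ inv (inv x)) (*ᴴ-inverseʳ x N≢0) ⟨
  x *ᴴ inv x *ᴴ inv (inv x)    ≡⟨ *ᴴ-inv-cancelʳ x (inv x) (normSq-inv≢0 x N≢0) ⟩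
  x                            ∎
  where open ≡-Reasoning

hur : ℚ → ℚ → ℚ → ℚ → Quat
hur x₀ x₁ x₂ x₃ = ofℚ x₀ +ᴴ ofℚ x₁ *ᴴ iᴴ +ᴴ ofℚ x₂ *ᴴ jᴴ +ᴴ ofℚ x₃ *ᴴ ξ

isHurwitz-hur : ∀ {x₀ x₁ x₂ x₃} → IsInteger x₀ → IsInteger x₁ → IsInteger x₂ → IsInteger x₃ →
                IsHurwitz (hur x₀ x₁ x₂ x₃)
isHurwitz-hur (m₀ , refl) (m₁ , refl) (m₂ , refl) (m₃ , refl) = m₀ , m₁ , m₂ , m₃ , refl

isHurwitz-1 : IsHurwitz 1ᴴ
isHurwitz-1 = + 1 , + 0 , + 0 , + 0 , refl

isHurwitz-0 : IsHurwitz 0ᴴ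
isHurwitz-0 = + 0 , + 0 , + 0 , + 0 , refl

-- Instance search recognises them, and
-- they take integer values at integer points, so a quaternion is Hurwitz as soon as the ring
-- solver writes it as hurᴾ p₀ p₁ p₂ p₃ with such pᵢ evaluated at integers.
data Integral {n : ℕ} : Polynomial n → Set where
  instance
    var-integral : ∀ {i} → Integral (var i)
    one-integral : Integral (con 1ℚ)
    +-integral   : ∀ {p q} → {{Integral p}} → {{Integral q}} → Integral (p :+ q)
    *-integral   : ∀ {p q} → {{Integral p}} → {{Integral q}} → Integral (p :* q)
    neg-integral : ∀ {p} → {{Integral p}} → Integral (:- p)

isInteger-+ : ∀ {r s} → IsInteger r → IsInteger s → IsInteger (r + s)
isInteger-+ (m , refl) (n , refl) = m ℤ.+ n , fromℤ-+ m n

isInteger-* : ∀ {r s} → IsInteger r → IsInteger s → IsInteger (r * s)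
isInteger-* (m , refl) (n , refl) = m ℤ.* n , fromℤ-* m n

isInteger-neg : ∀ {r} → IsInteger r → IsInteger (- r)
isInteger-neg (m , refl) = ℤ.- m , fromℤ-neg m

integral-isInteger : ∀ {n} {p : Polynomial n} → Integral p → (ρ : Vec ℤ n) →
                     IsInteger (⟦ p ⟧ (Vec.map fromℤ ρ))
integral-isInteger (var-integral {i}) ρ = Vec.lookup ρ i , sym (Vecₚ.lookup-map i fromℤ ρ)
integral-isInteger one-integral ρ = + 1 , refl
integral-isInteger (+-integral {{p}} {{q}}) ρ = isInteger-+ (integral-isInteger p ρ) (integral-isInteger q ρ)
integral-isInteger (*-integral {{p}} {{q}}) ρ = isInteger-* (integral-isInteger p ρ) (integral-isInteger q ρ)
integral-isInteger (neg-integral {{p}}) ρ = isInteger-neg (integral-isInteger p ρ)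

isHurwitz-byRing : ∀ {n} (ρ : Vec ℤ n) (X : Quatᴾ n) (p₀ p₁ p₂ p₃ : Polynomial n) →
  {{Integral p₀}} → {{Integral p₁}} → {{Integral p₂}} → {{Integral p₃}} →
  ⟦ X ⟧ᴴ↓ (Vec.map fromℤ ρ) ≡ ⟦ hurᴾ p₀ p₁ p₂ p₃ ⟧ᴴ↓ (Vec.map fromℤ ρ) →
  IsHurwitz (⟦ X ⟧ᴴ (Vec.map fromℤ ρ))
isHurwitz-byRing ρ X p₀ p₁ p₂ p₃ {{i₀}} {{i₁}} {{i₂}} {{i₃}} eq =
  subst IsHurwitz (sym (proveᴴ (Vec.map fromℤ ρ) X (hurᴾ p₀ p₁ p₂ p₃) eq))
    (isHurwitz-hur (integral-isInteger i₀ ρ) (integral-isInteger i₁ ρ)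
                   (integral-isInteger i₂ ρ) (integral-isInteger i₃ ρ))

isHurwitz-*ᴴ : ∀ {x y} → IsHurwitz x → IsHurwitz y → IsHurwitz (x *ᴴ y)
isHurwitz-*ᴴ (m₀ , m₁ , m₂ , m₃ , refl) (n₀ , n₁ , n₂ , n₃ , refl) =
  isHurwitz-byRing (m₀ ∷ m₁ ∷ m₂ ∷ m₃ ∷ n₀ ∷ n₁ ∷ n₂ ∷ n₃ ∷ [])
    (hurᴾ x₀ x₁ x₂ x₃ *ᴾ hurᴾ y₀ y₁ y₂ y₃)
    (x₀ :* y₀ :- x₁ :* (y₁ :+ y₂ :+ y₃) :+ x₂ :* (y₁ :- y₂) :- x₃ :* (y₂ :+ y₃))
    (x₀ :* y₁ :+ x₁ :* (y₀ :- y₂) :+ x₂ :* (y₁ :+ y₃) :+ x₃ :* (y₁ :- y₂))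
    (x₀ :* y₂ :- x₁ :* (y₂ :+ y₃) :+ x₂ :* (y₀ :+ y₁ :+ y₃) :+ x₃ :* y₁)
    (x₀ :* y₃ :+ x₁ :* (y₂ :+ y₂ :+ y₃) :- x₂ :* (y₁ :+ y₁ :+ y₃) :+ x₃ :* (y₀ :- y₁ :+ y₂ :+ y₃))
    refl
  where open Coordinates₈

isHurwitz--ᴴ : ∀ {x y} → IsHurwitz x → IsHurwitz y → IsHurwitz (x -ᴴ y)
isHurwitz--ᴴ (m₀ , m₁ , m₂ , m₃ , refl) (n₀ , n₁ , n₂ , n₃ , refl) =
  isHurwitz-byRing (m₀ ∷ m₁ ∷ m₂ ∷ m₃ ∷ n₀ ∷ n₁ ∷ n₂ ∷ n₃ ∷ [])
    (hurᴾ x₀ x₁ x₂ x₃ -ᴾ hurᴾ y₀ y₁ y₂ y₃) (x₀ :- y₀) (x₁ :- y₁) (x₂ :- y₂) (x₃ :- y₃) refl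
  where open Coordinates₈

isHurwitz-lipschitz : ∀ {a b c d} → IsInteger a → IsInteger b → IsInteger c → IsInteger d →
                      IsHurwitz (quat a b c d)
isHurwitz-lipschitz (m₀ , refl) (m₁ , refl) (m₂ , refl) (m₃ , refl) =
  isHurwitz-byRing (m₀ ∷ m₁ ∷ m₂ ∷ m₃ ∷ [])
    (quatᴾ x₀ x₁ x₂ x₃) (x₀ :- x₃) (x₁ :- x₃) (x₂ :- x₃) (x₃ :+ x₃) refl
  where open Coordinates₄

isHurwitz-halfLipschitz : ∀ k₀ k₁ k₂ k₃ →
  IsHurwitz (quat (fromℤ k₀ + ½) (fromℤ k₁ + ½) (fromℤ k₂ + ½) (fromℤ k₃ + ½))
isHurwitz-halfLipschitz k₀ k₁ k₂ k₃ =
  isHurwitz-byRing (k₀ ∷ k₁ ∷ k₂ ∷ k₃ ∷ [])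
    (quatᴾ (x₀ :+ con ½) (x₁ :+ con ½) (x₂ :+ con ½) (x₃ :+ con ½))
    (x₀ :- x₃) (x₁ :- x₃) (x₂ :- x₃) (x₃ :+ x₃ :+ con 1ℚ) refl
  where open Coordinates₄

normSq-isInteger : ∀ {β} → IsHurwitz β → IsInteger (normSq β)
normSq-isInteger (m₀ , m₁ , m₂ , m₃ , refl) =
  subst IsInteger (sym (prove (Vec.map fromℤ ms) (normSqᴾ (hurᴾ x₀ x₁ x₂ x₃)) N refl))
    (integral-isInteger {p = N} +-integral ms)
  where
  open Coordinates₄
  ms = m₀ ∷ m₁ ∷ m₂ ∷ m₃ ∷ []
  N = x₀ :* x₀ :+ x₁ :* x₁ :+ x₂ :* x₂ :+ x₃ :* (x₀ :+ x₁ :+ x₂ :+ x₃)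

-- Approximation by Hurwitz integers

frac : ℚ → ℚ
frac p = p - fromℤ (ℚ.floor p)

frac*denominator : ∀ p → frac p * fromℤ (↧ p) ≡ fromℤ (+ (↥ p % ↧ p))
frac*denominator p@(mkℚ n _ _) = begin
  (p - K) * D        ≡⟨ solve 3 (λ P K D → (P :- K) :* D := P :* D :- K :* D) refl p K D ⟩
  p * D - K * D      ≡⟨ cong (_- K * D) (*-denominator p) ⟩
  fromℤ n - K * D    ≡⟨ cong (λ m → fromℤ m - K * D) (a≡a%n+[a/n]*n n (↧ p)) ⟩
  fromℤ (+ r ℤ.+ k ℤ.* ↧ p) - K * D  ≡⟨ cong (_- K * D) (trans (fromℤ-+ (+ r) (k ℤ.* ↧ p)) (cong (_+_ R) (fromℤ-* k (↧ p)))) ⟩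
  R + K * D - K * D  ≡⟨ solve 2 (λ R KD → R :+ KD :- KD := R) refl R (K * D) ⟩
  R                  ∎
  where
  open ≡-Reasoning
  k = ℚ.floor p
  r = n % ↧ p
  K = fromℤ k
  D = fromℤ (↧ p)
  R = fromℤ (+ r)

frac-bounds : ∀ p → 0ℚ ≤ frac p × frac p < 1ℚ
frac-bounds p@(mkℚ n d-1 _) =
  ℚₚ.*-cancelʳ-≤-pos D (subst₂ _≤_ (sym (ℚₚ.*-zeroˡ D)) (sym (frac*denominator p)) (fromℤ-mono-≤ {+ 0} {+ (n % ↧ p)} (ℤ.+≤+ ℕ.z≤n))) ,
  ℚₚ.*-cancelʳ-<-nonNeg D {{ℚₚ.pos⇒nonNeg D}} (subst₂ _<_ (sym (frac*denominator p)) (sym (ℚₚ.*-identityˡ D))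
    (fromℤ-mono-< {+ (n % ↧ p)} {↧ p} (ℤ.+<+ (n%d<d n (↧ p)))))
  where
  D = fromℤ (↧ p)
  instance
    D-pos : ℚ.Positive D
    D-pos = ℚ.positive (fromℤ-pos (ℕ.suc d-1))

frac-defect : ℚ → ℚ
frac-defect p = frac p * (1ℚ - frac p)

0<1-frac : ∀ p → 0ℚ < 1ℚ - frac p
0<1-frac p = subst (_< 1ℚ - frac p) (ℚₚ.+-inverseʳ (frac p))
  (ℚₚ.+-mono-<-≤ (proj₂ (frac-bounds p)) (ℚₚ.≤-refl { - frac p}))

frac-defect-nonneg : ∀ p → 0ℚ ≤ frac-defect p
frac-defect-nonneg p = ℚₚ.nonNegative⁻¹ (frac-defect p)
  {{ℚₚ.nonNeg*nonNeg⇒nonNeg (frac p) {{ℚ.nonNegative (proj₁ (frac-bounds p))}}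
                             (1ℚ - frac p) {{ℚ.nonNegative (ℚₚ.<⇒≤ (0<1-frac p))}}}}

frac-defect-pos : ∀ p → frac p ≢ 0ℚ → 0ℚ < frac-defect p
frac-defect-pos p f≢0 = ℚₚ.positive⁻¹ (frac-defect p)
  {{ℚₚ.pos*pos⇒pos (frac p) {{ℚ.positive (nonneg∧≢0⇒pos (proj₁ (frac-bounds p)) f≢0)}}
                   (1ℚ - frac p) {{ℚ.positive (0<1-frac p)}}}}

frac-defect-≡0 : ∀ p → frac-defect p ≡ 0ℚ → IsInteger p
frac-defect-≡0 p δ≡0 = ℚ.floor p , sym (begin
  p                           ≡⟨ solve 2 (λ P K → P := (P :- K) :+ K) refl p (fromℤ (ℚ.floor p)) ⟩
  frac p + fromℤ (ℚ.floor p)  ≡⟨ cong (_+ fromℤ (ℚ.floor p)) f≡0 ⟩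
  0ℚ + fromℤ (ℚ.floor p)      ≡⟨ ℚₚ.+-identityˡ _ ⟩
  fromℤ (ℚ.floor p)           ∎)
  where
  open ≡-Reasoning
  f≡0 : frac p ≡ 0ℚ
  f≡0 with frac p ≟ 0ℚ
  ... | yes f≡0 = f≡0
  ... | no f≢0 = ⊥-elim (ℚₚ.<⇒≢ (frac-defect-pos p f≢0) (sym δ≡0))

normSq-centre : ∀ q₀ q₁ q₂ q₃ k₀ k₁ k₂ k₃ →
  normSq (quat (k₀ + ½) (k₁ + ½) (k₂ + ½) (k₃ + ½) -ᴴ quat q₀ q₁ q₂ q₃) ≡
  1ℚ - ((q₀ - k₀) * (1ℚ - (q₀ - k₀)) + (q₁ - k₁) * (1ℚ - (q₁ - k₁))
       + (q₂ - k₂) * (1ℚ - (q₂ - k₂)) + (q₃ - k₃) * (1ℚ - (q₃ - k₃)))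
normSq-centre q₀ q₁ q₂ q₃ k₀ k₁ k₂ k₃ = prove ([] ⨾ (q₀ ∷ q₁ ∷ q₂ ∷ q₃ ∷ k₀ ∷ k₁ ∷ k₂ ∷ k₃ ∷ []))
  (normSqᴾ (quatᴾ (y₀ :+ con ½) (y₁ :+ con ½) (y₂ :+ con ½) (y₃ :+ con ½) -ᴾ quatᴾ x₀ x₁ x₂ x₃))
  (con 1ℚ :- (δ x₀ y₀ :+ δ x₁ y₁ :+ δ x₂ y₂ :+ δ x₃ y₃)) refl
  where
  open Coordinates₈
  δ : Polynomial 8 → Polynomial 8 → Polynomial 8
  δ Q K = (Q :- K) :* (con 1ℚ :- (Q :- K))

-- The centre ⌊q⌋ + ξ of the unit cube containing q is a Hurwitz integer at squared distance
-- 1 − Σ fᵢ (1 − fᵢ) from q, where the fᵢ ∈ [0, 1) are the fractional parts of the coordinates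
-- of q; the sum vanishes only if every fᵢ does, and then q is a Lipschitz integer.
hurwitz-approximation : ∀ q → IsHurwitz q ⊎ ∃[ h ] IsHurwitz h × normSq (h -ᴴ q) < 1ℚ
hurwitz-approximation (quat q₀ q₁ q₂ q₃) = by-defect (δ ≟ 0ℚ)
  where
  δ = frac-defect q₀ + frac-defect q₁ + frac-defect q₂ + frac-defect q₃
  k₀ = ℚ.floor q₀
  k₁ = ℚ.floor q₁
  k₂ = ℚ.floor q₂
  k₃ = ℚ.floor q₃
  by-defect : Dec (δ ≡ 0ℚ) → IsHurwitz (quat q₀ q₁ q₂ q₃) ⊎ ∃[ h ] IsHurwitz h × normSq (h -ᴴ quat q₀ q₁ q₂ q₃) < 1ℚ
  by-defect (yes δ≡0) =
    let δ₀≡0 , δ₁≡0 , δ₂≡0 , δ₃≡0 = sum₄-nonneg-≡0 (frac-defect-nonneg q₀) (frac-defect-nonneg q₁)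
                                                    (frac-defect-nonneg q₂) (frac-defect-nonneg q₃) δ≡0
    in inj₁ (isHurwitz-lipschitz (frac-defect-≡0 q₀ δ₀≡0) (frac-defect-≡0 q₁ δ₁≡0)
                                 (frac-defect-≡0 q₂ δ₂≡0) (frac-defect-≡0 q₃ δ₃≡0))
  by-defect (no δ≢0) =
    inj₂ (_ , isHurwitz-halfLipschitz k₀ k₁ k₂ k₃ ,
          subst (_< 1ℚ) (sym (normSq-centre q₀ q₁ q₂ q₃ (fromℤ k₀) (fromℤ k₁) (fromℤ k₂) (fromℤ k₃)))
            (ℚₚ.+-mono-≤-< (ℚₚ.≤-refl {1ℚ}) (ℚₚ.neg-antimono-< (nonneg∧≢0⇒pos δ-nonneg δ≢0))))
    where
    δ-nonneg = sum₄-nonneg (frac-defect-nonneg q₀) (frac-defect-nonneg q₁)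
                           (frac-defect-nonneg q₂) (frac-defect-nonneg q₃)

-- shift h γ = (h −1; 1 0) γ, which sends ∞ to h − (γ ∞)⁻¹.
shift : Quat → Mat₂ → Mat₂
shift h (mat A B C D) = mat (h *ᴴ A -ᴴ C) (h *ᴴ B -ᴴ D) A B

dieudonnéSq-shift : ∀ h γ → dieudonnéSq (shift h γ) ≡ dieudonnéSq γ
dieudonnéSq-shift h (mat A B C D) = prove ((h ∷ A ∷ B ∷ C ∷ D ∷ []) ⨾ [])
  (dieudonnéSqᴾ (H *ᴾ Aᴾ -ᴾ Cᴾ) (H *ᴾ Bᴾ -ᴾ Dᴾ) Aᴾ Bᴾ) (dieudonnéSqᴾ Aᴾ Bᴾ Cᴾ Dᴾ) refl
  where
  open Variables 5 0
  H = 𝕢 (# 0)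
  Aᴾ = 𝕢 (# 1)
  Bᴾ = 𝕢 (# 2)
  Cᴾ = 𝕢 (# 3)
  Dᴾ = 𝕢 (# 4)

inSL₂Hur-shift : ∀ {h γ} → IsHurwitz h → InSL₂Hur γ → InSL₂Hur (shift h γ)
inSL₂Hur-shift {h} {γ@(mat A B C D)} h-hur (A-hur , B-hur , C-hur , D-hur , det≡1) =
  isHurwitz--ᴴ (isHurwitz-*ᴴ h-hur A-hur) C-hur , isHurwitz--ᴴ (isHurwitz-*ᴴ h-hur B-hur) D-hur ,
  A-hur , B-hur , trans (dieudonnéSq-shift h γ) det≡1

infix 4 _sends∞to_
_sends∞to_ : Mat₂ → Quat → Set
γ sends∞to q = normSq (c γ) ≢ 0ℚ × a γ *ᴴ inv (c γ) ≡ q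

act-∞ : ∀ γ {q} → γ sends∞to q → act γ ∞ ≡ fin q
act-∞ γ@(mat A B C D) (C≢0 , A/C≡q) = trans act≡ (cong fin A/C≡q)
  where
  act≡ : act γ ∞ ≡ fin (A *ᴴ inv C)
  -- act and inv split on the same test; inv-unfold exposes the branch inside inv.
  act≡ with normSq C ≟ 0ℚ
  ... | yes C≡0 = ⊥-elim (C≢0 C≡0)
  ... | no C≢0′ = cong fin (cong (A *ᴴ_) (inv-unfold C C≢0′))

InOrbit∞ : Quat → Set
InOrbit∞ q = ∃[ γ ] InSL₂Hur γ × γ sends∞to q

inOrbit∞-hurwitz : ∀ {q} → IsHurwitz q → InOrbit∞ q
inOrbit∞-hurwitz {q} q-hur =
  mat q 1ᴴ 1ᴴ 0ᴴ , (q-hur , isHurwitz-1 , isHurwitz-1 , isHurwitz-0 , det≡1) , (λ ()) , *ᴴ-identityʳ q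
  where
  det≡1 : dieudonnéSq (mat q 1ᴴ 1ᴴ 0ᴴ) ≡ 1ℚ
  det≡1 = prove ((q ∷ []) ⨾ []) (dieudonnéSqᴾ (𝕢 (# 0)) 1ᴾ 1ᴾ 0ᴾ) (con 1ℚ) refl
    where open Variables 1 0

inOrbit∞-shift : ∀ {h p} → IsHurwitz h → normSq p ≢ 0ℚ → InOrbit∞ p → InOrbit∞ (h -ᴴ inv p)
inOrbit∞-shift {h} {p} h-hur p≢0 (γ@(mat A B C D) , γ-SL₂ , C≢0 , A/C≡p) =
  shift h γ , inSL₂Hur-shift h-hur γ-SL₂ , A≢0 , (begin
    (h *ᴴ A -ᴴ C) *ᴴ inv A           ≡⟨ *ᴴ-distribʳ--ᴴ (h *ᴴ A) C (inv A) ⟩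
    h *ᴴ A *ᴴ inv A -ᴴ C *ᴴ inv A    ≡⟨ cong₂ _-ᴴ_ (*ᴴ-inv-cancelʳ h A A≢0) C/A≡p⁻¹ ⟩
    h -ᴴ inv p                       ∎)
  where
  open ≡-Reasoning
  A≡pC : A ≡ p *ᴴ C
  A≡pC = trans (sym (*ᴴ-inv-cancelʳ′ A C C≢0)) (cong (_*ᴴ C) A/C≡p)
  A≢0 : normSq A ≢ 0ℚ
  A≢0 = subst (λ x → normSq x ≢ 0ℚ) (sym A≡pC) (normSq-*ᴴ≢0 p C p≢0 C≢0)
  C/A≡p⁻¹ : C *ᴴ inv A ≡ inv p
  C/A≡p⁻¹ = begin
    C *ᴴ inv A                 ≡⟨ cong (_*ᴴ inv A) (inv-*ᴴ-cancelˡ C p p≢0) ⟨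
    inv p *ᴴ (p *ᴴ C) *ᴴ inv A ≡⟨ cong (λ x → inv p *ᴴ x *ᴴ inv A) A≡pC ⟨
    inv p *ᴴ A *ᴴ inv A        ≡⟨ *ᴴ-inv-cancelʳ (inv p) A A≢0 ⟩
    inv p                      ∎

inOrbit∞-invert : ∀ {h q} → IsHurwitz h → normSq (h -ᴴ q) ≢ 0ℚ → InOrbit∞ (inv (h -ᴴ q)) → InOrbit∞ q
inOrbit∞-invert {h} {q} h-hur x≢0 orbit =
  subst InOrbit∞ (trans (cong (h -ᴴ_) (inv-involutive (h -ᴴ q) x≢0)) (x-ᴴ[x-ᴴy]≡y h q))
    (inOrbit∞-shift h-hur (normSq-inv≢0 (h -ᴴ q) x≢0) orbit)

-- Descent on the norm of a denominator

HurwitzDenominator : Quat → Quat → Set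
HurwitzDenominator q β = IsHurwitz β × normSq β ≢ 0ℚ × IsHurwitz (q *ᴴ β)

hurwitz-denominator : ∀ q → ∃[ β ] HurwitzDenominator q β
hurwitz-denominator q@(quat q₀ q₁ q₂ q₃) = ofℚ D ,
  isHurwitz-lipschitz (+ n , refl) (+ 0 , refl) (+ 0 , refl) (+ 0 , refl) ,
  subst (_≢ 0ℚ) (sym (normSq-ofℚ D)) (≢-sym (ℚₚ.<⇒≢ (square-pos D (≢-sym (ℚₚ.<⇒≢ (fromℤ-pos n)))))) ,
  subst IsHurwitz (sym (*ᴴ-ofℚ q D))
    (isHurwitz-lipschitz (denominator-clears q₀ (∣m⇒∣m*n d₃ (∣m⇒∣m*n d₂ (m∣m*n d₁))))
                         (denominator-clears q₁ (∣m⇒∣m*n d₃ (∣m⇒∣m*n d₂ (n∣m*n d₀))))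
                         (denominator-clears q₂ (∣m⇒∣m*n d₃ (n∣m*n (d₀ ℕ.* d₁))))
                         (denominator-clears q₃ (n∣m*n (d₀ ℕ.* d₁ ℕ.* d₂))))
  where
  d₀ = ↧ₙ q₀
  d₁ = ↧ₙ q₁
  d₂ = ↧ₙ q₂
  d₃ = ↧ₙ q₃
  n = d₀ ℕ.* d₁ ℕ.* d₂ ℕ.* d₃
  D = fromℤ (+ n)

normSq-natural : ∀ {β} → IsHurwitz β → ∃[ k ] fromℤ (+ k) ≡ normSq β
normSq-natural {β} β-hur with normSq-isInteger β-hur
... | m , m≡N = ℤ.∣ m ∣ , trans (cong fromℤ (ℤₚ.0≤i⇒+∣i∣≡i 0≤m)) m≡N
  where
  0≤m : + 0 ℤ.≤ m
  0≤m = fromℤ-cancel-≤ {+ 0} {m} (subst (0ℚ ≤_) (sym m≡N) (normSq-nonneg β))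

denominator-step : ∀ {q β h} → HurwitzDenominator q β → IsHurwitz h → normSq (h -ᴴ q) ≢ 0ℚ →
                   HurwitzDenominator (inv (h -ᴴ q)) ((h -ᴴ q) *ᴴ β)
denominator-step {q} {β} {h} (β-hur , β≢0 , qβ-hur) h-hur x≢0 =
  subst IsHurwitz (sym (*ᴴ-distribʳ--ᴴ h q β)) (isHurwitz--ᴴ (isHurwitz-*ᴴ h-hur β-hur) qβ-hur) ,
  normSq-*ᴴ≢0 (h -ᴴ q) β x≢0 β≢0 ,
  subst IsHurwitz (sym (inv-*ᴴ-cancelˡ β (h -ᴴ q) x≢0)) β-hur

normSq-natural-< : ∀ {β β′ k} → IsHurwitz β′ → normSq β′ < normSq β → fromℤ (+ k) ≡ normSq β →
                   ∃[ j ] j ℕ.< k × fromℤ (+ j) ≡ normSq β′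
normSq-natural-< {β} {β′} {k} β′-hur β′<β k≡Nβ = smaller (normSq-natural β′-hur)
  where
  smaller : ∃[ j ] fromℤ (+ j) ≡ normSq β′ → ∃[ j ] j ℕ.< k × fromℤ (+ j) ≡ normSq β′
  smaller (j , j≡Nβ′) =
    j , ℤₚ.drop‿+<+ (fromℤ-cancel-< {+ j} {+ k} (subst₂ _<_ (sym j≡Nβ′) (sym k≡Nβ) β′<β)) , j≡Nβ′

normSq-*ᴴ-< : ∀ x β → normSq x < 1ℚ → normSq β ≢ 0ℚ → normSq (x *ᴴ β) < normSq β
normSq-*ᴴ-< x β x<1 β≢0 = subst₂ _<_ (sym (normSq-*ᴴ x β)) (ℚₚ.*-identityˡ (normSq β))
  (ℚₚ.*-monoˡ-<-pos (normSq β) {{ℚ.positive (normSq-pos β β≢0)}} x<1)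

inOrbit∞-descent : ∀ k {q β} → HurwitzDenominator q β → fromℤ (+ k) ≡ normSq β → InOrbit∞ q
inOrbit∞-descent = <-rec _ step
  where
  Goal : ℕ → Set
  Goal k = ∀ {q β} → HurwitzDenominator q β → fromℤ (+ k) ≡ normSq β → InOrbit∞ q
  step : ∀ k → (∀ {j} → j ℕ.< k → Goal j) → Goal k
  step k rec {q} {β} den k≡Nβ = [ inOrbit∞-hurwitz , approach ]′ (hurwitz-approximation q)
    where
    approach : ∃[ h ] IsHurwitz h × normSq (h -ᴴ q) < 1ℚ → InOrbit∞ q
    approach (h , h-hur , x<1) = by-distance (normSq (h -ᴴ q) ≟ 0ℚ)
      where
      by-distance : Dec (normSq (h -ᴴ q) ≡ 0ℚ) → InOrbit∞ q
      by-distance (yes x≡0) = inOrbit∞-hurwitz (subst IsHurwitz (normSq[x-ᴴy]≡0⇒x≡y h q x≡0) h-hur)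
      by-distance (no x≢0) = descend (normSq-natural-< {β = β} (proj₁ den′) (normSq-*ᴴ-< (h -ᴴ q) β x<1 β≢0) k≡Nβ)
        where
        β≢0 = proj₁ (proj₂ den)
        den′ : HurwitzDenominator (inv (h -ᴴ q)) ((h -ᴴ q) *ᴴ β)
        den′ = denominator-step den h-hur x≢0
        descend : ∃[ j ] j ℕ.< k × fromℤ (+ j) ≡ normSq ((h -ᴴ q) *ᴴ β) → InOrbit∞ q
        descend (j , j<k , j≡Nβ′) = inOrbit∞-invert h-hur x≢0 (rec j<k den′ j≡Nβ′)

inOrbit∞-every : ∀ q → InOrbit∞ q
inOrbit∞-every q =
  let β , den = hurwitz-denominator q
      k , k≡Nβ = normSq-natural (proj₁ den)
  in inOrbit∞-descent k den k≡Nβ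

mainTheorem4 : (x : Point) → InOrbit ∞ x
mainTheorem4 ∞ = mat 1ᴴ 0ᴴ 0ᴴ 1ᴴ , (isHurwitz-1 , isHurwitz-0 , isHurwitz-0 , isHurwitz-1 , refl) , refl
mainTheorem4 (fin q) = let γ , γ-SL₂ , γ∞≡q = inOrbit∞-every q in γ , γ-SL₂ , act-∞ γ γ∞≡q
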